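{- Let $G$ be a graph of order $n$ and let $u,v$ be two vertices of $G$ with $d(u)+d(v)\ge n+1$. If $P$ is an ore $(u,v)$-path of $G$, then there exists a path in $G$ with endpoints $u$ and $v$ which contains all the vertices of $P$.
   Context: All graphs are finite, undirected, without loops or multiple edges; $d(w)$ denotes the degree of a vertex $w$ in $G$. For $k\ge 2$, a sequence of (distinct) vertices $P=v_1v_2\dots v_k$ of $G$ is an ore $(v_1,v_k)$-path of $G$ if for every $i$ with $1\le i\le k-1$, either $v_iv_{i+1}\in E(G)$ or $d(v_i)+d(v_{i+1})\ge n+1$. -}

module Defs where

open import Data.Nat using (ℕ; _+_; _≥_; _≤_)
open import Data.Fin using (Fin)
open import Data.List using (List; []; _∷_; length; filter; allFin; head; last)
open import Data.List.Relation.Unary.Unique.Propositional using (Unique)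
open import Data.Maybe using (just)
open import Data.Sum using (_⊎_)
open import Data.Product using (_×_)
open import Relation.Nullary using (¬_; Dec)
open import Relation.Binary.PropositionalEquality using (_≡_)

record Graph (n : ℕ) : Set₁ where
  field
    Adj    : Fin n → Fin n → Set
    adj?   : (x y : Fin n) → Dec (Adj x y)
    sym    : ∀ {x y} → Adj x y → Adj y x
    irrefl : ∀ {x} → ¬ Adj x x

  deg : Fin n → ℕ
  deg w = length (filter (adj? w) (allFin n))

open Graph public

data Chain {A : Set} (R : A → A → Set) : List A → Set where
  []  : Chain R []
  [-] : ∀ {x} → Chain R (x ∷ [])
  _∷_ : ∀ {x y xs} → R x y → Chain R (y ∷ xs) → Chain R (x ∷ y ∷ xs)

HasEnds : ∀ {A : Set} → A → A → List A → Set
HasEnds u v xs = (head xs ≡ just u) × (last xs ≡ just v)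

IsPath : ∀ {n} (G : Graph n) → Fin n → Fin n → List (Fin n) → Set
IsPath G u v xs = Unique xs × Chain (Adj G) xs × HasEnds u v xs

OreStep : ∀ {n} (G : Graph n) → Fin n → Fin n → Set
OreStep {n} G x y = Adj G x y ⊎ (n + 1 ≤ deg G x + deg G y)

IsOrePath : ∀ {n} (G : Graph n) → Fin n → Fin n → List (Fin n) → Set
IsOrePath G u v xs = (2 ≤ length xs) × Unique xs × Chain (OreStep G) xs × HasEnds u v xs

{-# OPTIONS --safe #-}
module Submission where

-- Repair the non-adjacent consecutive pairs of an ore path one at a time.  For such a pair
-- x y we have d(x) + d(y) ≥ n + 1, and either x and y have a common neighbour off the path
-- (insert it between them), or the path, traversed from one of x, y away from the other,
-- has consecutive vertices c, d with c adjacent to the far vertex of the pair and d to the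
-- near one (reverse the segment from the near vertex to c).  Otherwise each vertex off the
-- path is adjacent to at most one of x, y, and on each side of the pair the neighbours of
-- the far vertex miss the predecessors of the neighbours of the near one, so
-- d(x) + d(y) ≤ n.

open import Defs hiding (sym)
open import Data.Nat using (ℕ; suc; _+_; _≤_; _<_; z≤n; s≤s)
open import Data.Nat.Properties
open import Data.Nat.Induction using (<-wellFounded)
open import Algebra.Properties.CommutativeSemigroup +-commutativeSemigroup using (interchange)
open import Data.Bool using (if_then_else_)
open import Data.Fin using (Fin)
import Data.Fin.Properties as Fin
open import Data.List using (List; []; _∷_; _++_; _∷ʳ_; [_]; length; filter; reverse; head; last; allFin)
open import Data.List.Properties
  using ( ++-assoc; unfold-reverse; reverse-++; reverse-involutive
        ; length-++; length-reverse; length-tabulate; length-filter; filter-++; filter-reject )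
open import Data.List.Membership.Propositional using (_∈_; _∉_; find)
open import Data.List.Membership.Propositional.Properties
  using (∈-filter⁺; ∈-filter⁻; ∈-++⁺ˡ; ∈-++⁺ʳ; ∈-++⁻; ∈-allFin)
open import Data.List.Membership.Propositional.Properties.WithK using (unique∧set⇒bag)
import Data.List.Membership.DecPropositional as DecMembership
open import Data.List.Relation.Unary.All using (All; []; _∷_)
open import Data.List.Relation.Unary.All.Properties using (¬Any⇒All¬)
open import Data.List.Relation.Unary.AllPairs using (_∷_)
open import Data.List.Relation.Unary.Any using (there; any?)
open import Data.List.Relation.Unary.Unique.Propositional using (Unique)
import Data.List.Relation.Unary.Unique.Propositional.Properties as Unique
open import Data.List.Relation.Binary.BagAndSetEquality using (∼bag⇒↭)
open import Data.List.Relation.Binary.Permutation.Propositional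
  using (_↭_; ↭-refl; ↭-sym; ↭-trans; ↭-reflexive; prep; swap; ↭⇒↭ₛ)
open import Data.List.Relation.Binary.Permutation.Propositional.Properties
  using (∈-resp-↭; ↭-reverse; ↭-length; filter-↭; ++⁺ˡ; ++⁺ʳ; shift)
import Data.List.Relation.Binary.Permutation.Setoid.Properties as PermutationSetoid
open import Data.List.Relation.Binary.Subset.Propositional using (_⊆_)
open import Data.Product using (Σ; _×_; _,_; proj₁; proj₂)
open import Data.Sum using (_⊎_; inj₁; inj₂)
open import Function using (_∘_)
open import Function.Bundles using (mk⇔)
open import Induction.WellFounded using (Acc; acc)
open import Relation.Binary.Definitions using (DecidableEquality; Symmetric)
open import Relation.Binary.PropositionalEquality
  using (_≡_; refl; sym; trans; cong; cong₂; subst; subst₂; setoid; module ≡-Reasoning)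
open import Relation.Nullary using (¬_; Dec; yes; no; ¬?; contradiction)
open import Relation.Nullary.Decidable using (does; dec-true; dec-false; decidable-stable; _×-dec_)
open import Relation.Unary using (Decidable)

module _ {A : Set} where

  reverse-∷∷ : ∀ (a b : A) xs → reverse (a ∷ b ∷ xs) ≡ reverse xs ∷ʳ b ∷ʳ a
  reverse-∷∷ a b xs = trans (unfold-reverse a (b ∷ xs)) (cong (_∷ʳ a) (unfold-reverse b xs))

  reverse-∷-∷ʳ : ∀ (a : A) xs b → reverse (a ∷ xs ∷ʳ b) ≡ b ∷ reverse xs ∷ʳ a
  reverse-∷-∷ʳ a xs b = trans (unfold-reverse a (xs ∷ʳ b)) (cong (_∷ʳ a) (reverse-++ xs [ b ]))

  reverse-++-∷∷ : ∀ xs (a b : A) ys → reverse (xs ++ a ∷ b ∷ ys) ≡ reverse ys ++ b ∷ a ∷ reverse xs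
  reverse-++-∷∷ xs a b ys = begin
    reverse (xs ++ a ∷ b ∷ ys)           ≡⟨ reverse-++ xs (a ∷ b ∷ ys) ⟩
    reverse (a ∷ b ∷ ys) ++ reverse xs   ≡⟨ cong (_++ reverse xs) (reverse-∷∷ a b ys) ⟩
    (reverse ys ∷ʳ b ∷ʳ a) ++ reverse xs ≡⟨ ++-assoc (reverse ys ∷ʳ b) [ a ] (reverse xs) ⟩
    (reverse ys ∷ʳ b) ++ a ∷ reverse xs  ≡⟨ ++-assoc (reverse ys) [ b ] (a ∷ reverse xs) ⟩
    reverse ys ++ b ∷ a ∷ reverse xs     ∎
    where open ≡-Reasoning

  head-++-∷ : ∀ xs {y : A} {ys} → head (xs ++ y ∷ ys) ≡ head (xs ∷ʳ y)
  head-++-∷ []      = refl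
  head-++-∷ (_ ∷ _) = refl

  last-++-∷ : ∀ xs {y : A} {ys} → last (xs ++ y ∷ ys) ≡ last (y ∷ ys)
  last-++-∷ []            = refl
  last-++-∷ (_ ∷ [])      = refl
  last-++-∷ (_ ∷ x ∷ xs) = last-++-∷ (x ∷ xs)

  last-reverse : ∀ (xs : List A) → last (reverse xs) ≡ head xs
  last-reverse []       = refl
  last-reverse (x ∷ xs) = trans (cong last (unfold-reverse x xs)) (last-++-∷ (reverse xs))

  head-reverse : ∀ (xs : List A) → head (reverse xs) ≡ last xs
  head-reverse xs = trans (sym (last-reverse (reverse xs))) (cong last (reverse-involutive xs))

  HasEnds-reverse : ∀ {u v : A} {xs} → HasEnds u v xs → HasEnds v u (reverse xs)
  HasEnds-reverse {xs = xs} (first , final) = trans (head-reverse xs) final , trans (last-reverse xs) first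

  HasEnds-splice : ∀ {u v : A} ws x ms {ms′} z zs →
    HasEnds u v (ws ++ x ∷ ms ++ z ∷ zs) → HasEnds u v (ws ++ x ∷ ms′ ++ z ∷ zs)
  HasEnds-splice ws x ms {ms′} z zs (first , final) =
    trans (head-++-∷ ws) (trans (sym (head-++-∷ ws)) first) ,
    trans (last-middle ms′) (trans (sym (last-middle ms)) final)
    where
    last-middle : ∀ ns → last (ws ++ x ∷ ns ++ z ∷ zs) ≡ last (z ∷ zs)
    last-middle ns = trans (cong last (sym (++-assoc ws (x ∷ ns) (z ∷ zs)))) (last-++-∷ (ws ++ x ∷ ns))

  unique-↭ : ∀ {xs ys : List A} → xs ↭ ys → Unique xs → Unique ys
  unique-↭ p = PermutationSetoid.Unique-resp-↭ (setoid A) (↭⇒↭ₛ p)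

  module _ (_≟_ : DecidableEquality A) where
    open DecMembership _≟_ using (_∈?_; _∉?_)

    ↭-++-complement : ∀ {xs ys} → Unique xs → Unique ys → xs ⊆ ys → ys ↭ xs ++ filter (_∉? xs) ys
    ↭-++-complement {xs} {ys} !xs !ys xs⊆ys =
      ∼bag⇒↭ (unique∧set⇒bag !ys !xs++rest (mk⇔ to from))
      where
      rest⊆ys : ∀ {z} → z ∈ filter (_∉? xs) ys → z ∈ ys × z ∉ xs
      rest⊆ys = ∈-filter⁻ (_∉? xs) {xs = ys}
      disjoint : ∀ {z} → ¬ (z ∈ xs × z ∈ filter (_∉? xs) ys)
      disjoint (z∈xs , z∈rest) = proj₂ (rest⊆ys z∈rest) z∈xs
      !xs++rest : Unique (xs ++ filter (_∉? xs) ys)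
      !xs++rest = Unique.++⁺ !xs (Unique.filter⁺ (_∉? xs) !ys) disjoint
      to : ∀ {z} → z ∈ ys → z ∈ xs ++ filter (_∉? xs) ys
      to {z} z∈ys with z ∈? xs
      ... | yes z∈xs = ∈-++⁺ˡ z∈xs
      ... | no  z∉xs = ∈-++⁺ʳ xs (∈-filter⁺ (_∉? xs) z∈ys z∉xs)
      from : ∀ {z} → z ∈ xs ++ filter (_∉? xs) ys → z ∈ ys
      from z∈ with ∈-++⁻ xs z∈
      ... | inj₁ z∈xs   = xs⊆ys z∈xs
      ... | inj₂ z∈rest = proj₁ (rest⊆ys z∈rest)

module _ {A : Set} {R : A → A → Set} where

  Chain-map : ∀ {S : A → A → Set} → (∀ {a b} → R a b → S a b) → ∀ {xs} → Chain R xs → Chain S xs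
  Chain-map f []      = []
  Chain-map f [-]     = [-]
  Chain-map f (r ∷ c) = f r ∷ Chain-map f c

  Chain-head : ∀ {x y xs} → Chain R (x ∷ y ∷ xs) → R x y
  Chain-head (r ∷ _) = r

  Chain-tail : ∀ {x xs} → Chain R (x ∷ xs) → Chain R xs
  Chain-tail [-]     = []
  Chain-tail (_ ∷ c) = c

  Chain-++⁺ : ∀ xs {y ys} → Chain R (xs ∷ʳ y) → Chain R (y ∷ ys) → Chain R (xs ++ y ∷ ys)
  Chain-++⁺ []            _       c′ = c′
  Chain-++⁺ (_ ∷ [])      (r ∷ _) c′ = r ∷ c′
  Chain-++⁺ (_ ∷ x ∷ xs) (r ∷ c) c′ = r ∷ Chain-++⁺ (x ∷ xs) c c′

  Chain-++⁻ˡ : ∀ xs {y ys} → Chain R (xs ++ y ∷ ys) → Chain R (xs ∷ʳ y)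
  Chain-++⁻ˡ []            _       = [-]
  Chain-++⁻ˡ (_ ∷ [])      (r ∷ _) = r ∷ [-]
  Chain-++⁻ˡ (_ ∷ x ∷ xs) (r ∷ c) = r ∷ Chain-++⁻ˡ (x ∷ xs) c

  Chain-++⁻ʳ : ∀ xs {y ys} → Chain R (xs ++ y ∷ ys) → Chain R (y ∷ ys)
  Chain-++⁻ʳ []       c = c
  Chain-++⁻ʳ (_ ∷ xs) c = Chain-++⁻ʳ xs (Chain-tail c)

  Chain-∷ʳ : ∀ xs {a b} → Chain R (xs ∷ʳ a) → R a b → Chain R (xs ∷ʳ a ∷ʳ b)
  Chain-∷ʳ []            _       r = r ∷ [-]
  Chain-∷ʳ (_ ∷ [])      (s ∷ _) r = s ∷ r ∷ [-]
  Chain-∷ʳ (_ ∷ x ∷ xs) (s ∷ c) r = s ∷ Chain-∷ʳ (x ∷ xs) c r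

  Chain-reverse : Symmetric R → ∀ {xs} → Chain R xs → Chain R (reverse xs)
  Chain-reverse R-sym []  = []
  Chain-reverse R-sym [-] = [-]
  Chain-reverse R-sym (_∷_ {x} {y} {xs} r c) =
    subst (Chain R) (sym (reverse-∷∷ x y xs))
      (Chain-∷ʳ (reverse xs) (subst (Chain R) (unfold-reverse y xs) (Chain-reverse R-sym c)) (R-sym r))

  Chain-splice : ∀ ws x ms {ms′} z zs →
    Chain R (ws ++ x ∷ ms ++ z ∷ zs) → Chain R (x ∷ ms′ ∷ʳ z) →
    Chain R (ws ++ x ∷ ms′ ++ z ∷ zs)
  Chain-splice ws x ms {ms′} z zs c c′ =
    Chain-++⁺ ws (Chain-++⁻ˡ ws c)
      (Chain-++⁺ (x ∷ ms′) c′ (Chain-++⁻ʳ (x ∷ ms) (Chain-++⁻ʳ ws c)))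

  data Split (xs : List A) : Set where
    split : ∀ ys {a b} zs → xs ≡ ys ++ a ∷ b ∷ zs → R a b → Split xs

  chain-or-split : (∀ a b → Dec (R a b)) → ∀ xs → Chain (λ a b → ¬ R a b) xs ⊎ Split xs
  chain-or-split R? []           = inj₁ []
  chain-or-split R? (_ ∷ [])     = inj₁ [-]
  chain-or-split R? (a ∷ b ∷ xs) with R? a b | chain-or-split R? (b ∷ xs)
  ... | yes r | _                       = inj₂ (split [] xs refl r)
  ... | no ¬r | inj₁ c                  = inj₁ (¬r ∷ c)
  ... | no ¬r | inj₂ (split ys zs eq r) = inj₂ (split (a ∷ ys) zs (cong (a ∷_) eq) r)

IsRoute : {A : Set} → (A → A → Set) → A → A → List A → Set
IsRoute R u v xs = Unique xs × Chain R xs × HasEnds u v xs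

module _ {A : Set} {R : A → A → Set} where

  IsRoute-reverse : Symmetric R → ∀ {u v xs} → IsRoute R u v xs → IsRoute R v u (reverse xs)
  IsRoute-reverse R-sym {xs = xs} (!xs , c , ends) =
    unique-↭ (↭-sym (↭-reverse xs)) !xs , Chain-reverse R-sym c , HasEnds-reverse ends

  IsRoute-splice : ∀ {u v} ws (x : A) ms {ms′} z zs → IsRoute R u v (ws ++ x ∷ ms ++ z ∷ zs) →
    Unique (ws ++ x ∷ ms′ ++ z ∷ zs) → Chain R (x ∷ ms′ ∷ʳ z) →
    IsRoute R u v (ws ++ x ∷ ms′ ++ z ∷ zs)
  IsRoute-splice ws x ms z zs (_ , c , ends) !xs′ c′ =
    !xs′ , Chain-splice ws x ms z zs c c′ , HasEnds-splice ws x ms z zs ends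

module Breaks {A : Set} {R : A → A → Set} (R? : ∀ a b → Dec (R a b)) where

  gap : A → A → ℕ
  gap a b = if does (R? a b) then 0 else 1

  breaks : List A → ℕ
  breaks []           = 0
  breaks (_ ∷ [])     = 0
  breaks (a ∷ b ∷ xs) = gap a b + breaks (b ∷ xs)

  gap-related : ∀ {a b} → R a b → gap a b ≡ 0
  gap-related {a} {b} r rewrite dec-true (R? a b) r = refl

  gap-unrelated : ∀ {a b} → ¬ R a b → gap a b ≡ 1
  gap-unrelated {a} {b} ¬r rewrite dec-false (R? a b) ¬r = refl

  gap-sym : Symmetric R → ∀ a b → gap a b ≡ gap b a
  gap-sym R-sym a b with R? a b | R? b a
  ... | yes _ | yes _ = refl
  ... | yes r | no ¬r = contradiction (R-sym r) ¬r
  ... | no ¬r | yes r = contradiction (R-sym r) ¬r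
  ... | no _  | no _  = refl

  breaks-++ : ∀ xs {y ys} → breaks (xs ++ y ∷ ys) ≡ breaks (xs ∷ʳ y) + breaks (y ∷ ys)
  breaks-++ []                = refl
  breaks-++ (a ∷ []) {y} {ys} = cong (_+ breaks (y ∷ ys)) (sym (+-identityʳ (gap a y)))
  breaks-++ (a ∷ b ∷ xs)      = trans (cong (gap a b +_) (breaks-++ (b ∷ xs))) (sym (+-assoc (gap a b) _ _))

  breaks-∷ʳ : ∀ xs {a b} → breaks (xs ∷ʳ a ∷ʳ b) ≡ breaks (xs ∷ʳ a) + gap a b
  breaks-∷ʳ xs {a} {b} =
    trans (cong breaks (++-assoc xs [ a ] [ b ]))
      (trans (breaks-++ xs) (cong (breaks (xs ∷ʳ a) +_) (+-identityʳ (gap a b))))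

  breaks-reverse : Symmetric R → ∀ xs → breaks (reverse xs) ≡ breaks xs
  breaks-reverse R-sym []           = refl
  breaks-reverse R-sym (_ ∷ [])     = refl
  breaks-reverse R-sym (a ∷ b ∷ xs) = begin
    breaks (reverse (a ∷ b ∷ xs))        ≡⟨ cong breaks (reverse-∷∷ a b xs) ⟩
    breaks (reverse xs ∷ʳ b ∷ʳ a)        ≡⟨ breaks-∷ʳ (reverse xs) ⟩
    breaks (reverse xs ∷ʳ b) + gap b a   ≡⟨ cong (λ ys → breaks ys + gap b a) (sym (unfold-reverse b xs)) ⟩
    breaks (reverse (b ∷ xs)) + gap b a  ≡⟨ cong₂ _+_ (breaks-reverse R-sym (b ∷ xs)) (gap-sym R-sym b a) ⟩
    breaks (b ∷ xs) + gap a b            ≡⟨ +-comm _ (gap a b) ⟩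
    gap a b + breaks (b ∷ xs)            ∎
    where open ≡-Reasoning

  breaks-splice : ∀ ws x ms z zs →
    breaks (ws ++ x ∷ ms ++ z ∷ zs) ≡ breaks (ws ∷ʳ x) + (breaks (x ∷ ms ∷ʳ z) + breaks (z ∷ zs))
  breaks-splice ws x ms z zs = trans (breaks-++ ws) (cong (breaks (ws ∷ʳ x) +_) (breaks-++ (x ∷ ms)))

  breaks-splice-< : ∀ ws x {ms ms′} z zs → breaks (x ∷ ms′ ∷ʳ z) < breaks (x ∷ ms ∷ʳ z) →
    breaks (ws ++ x ∷ ms′ ++ z ∷ zs) < breaks (ws ++ x ∷ ms ++ z ∷ zs)
  breaks-splice-< ws x {ms} {ms′} z zs fewer =
    subst₂ _<_ (sym (breaks-splice ws x ms′ z zs)) (sym (breaks-splice ws x ms z zs))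
      (+-monoʳ-< (breaks (ws ∷ʳ x)) (+-monoˡ-< (breaks (z ∷ zs)) fewer))

module _ {A : Set} {P Q : A → Set} (P? : Decidable P) (Q? : Decidable Q) where

  length-filter-+-≤-length : ∀ {xs} → All (λ a → ¬ (P a × Q a)) xs →
    length (filter P? xs) + length (filter Q? xs) ≤ length xs
  length-filter-+-≤-length [] = z≤n
  length-filter-+-≤-length {a ∷ xs} (¬PQ ∷ h) with P? a | Q? a
  ... | yes p | yes q = contradiction (p , q) ¬PQ
  ... | yes _ | no _  = s≤s (length-filter-+-≤-length h)
  ... | no _  | yes _ = ≤-trans (≤-reflexive (+-suc _ _)) (s≤s (length-filter-+-≤-length h))
  ... | no _  | no _  = m≤n⇒m≤1+n (length-filter-+-≤-length h)

  length-filter-shifted-≤ : ∀ a xs → Chain (λ a b → ¬ (P a × Q b)) (a ∷ xs) →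
    length (filter P? (a ∷ xs)) + length (filter Q? xs) ≤ suc (length xs)
  length-filter-shifted-≤ a []       _         =
    ≤-trans (≤-reflexive (+-identityʳ _)) (length-filter P? (a ∷ []))
  length-filter-shifted-≤ a (b ∷ xs) (¬PQ ∷ c) with P? a | Q? b
  ... | yes p | yes q = contradiction (p , q) ¬PQ
  ... | yes _ | no _  = s≤s (length-filter-shifted-≤ b xs c)
  ... | no _  | yes _ = ≤-trans (≤-reflexive (+-suc _ _)) (s≤s (length-filter-shifted-≤ b xs c))
  ... | no _  | no _  = m≤n⇒m≤1+n (length-filter-shifted-≤ b xs c)

  length-filter-+-≤-suc-length : ∀ {xs} → Chain (λ a b → ¬ (P a × Q b)) xs →
    length (filter P? xs) + length (filter Q? xs) ≤ suc (length xs)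
  length-filter-+-≤-suc-length {[]}     _ = z≤n
  length-filter-+-≤-suc-length {a ∷ xs} c with Q? a
  ... | yes _ = ≤-trans (≤-reflexive (+-suc _ _)) (s≤s (length-filter-shifted-≤ a xs c))
  ... | no _  = m≤n⇒m≤1+n (length-filter-shifted-≤ a xs c)

module _ {n : ℕ} (G : Graph n) where

  open Breaks (adj? G) renaming (breaks to defects)
  open DecMembership (Fin._≟_ {n}) using (_∉?_)

  infix 4 _~_
  _~_ : Fin n → Fin n → Set
  _~_ = Adj G

  ~-sym : Symmetric _~_
  ~-sym = Graph.sym G

  Ore : Fin n → Fin n → Set
  Ore = OreStep G

  ore-sym : Symmetric Ore
  ore-sym (inj₁ x~y)         = inj₁ (~-sym x~y)
  ore-sym {x} {y} (inj₂ big) = inj₂ (subst (n + 1 ≤_) (+-comm (deg G x) (deg G y)) big)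

  ore-degree : ∀ {x y} → Ore x y → ¬ x ~ y → n + 1 ≤ deg G x + deg G y
  ore-degree (inj₁ x~y) x≁y = contradiction x~y x≁y
  ore-degree (inj₂ big) _   = big

  record Repair (u v : Fin n) (Q : List (Fin n)) : Set where
    constructor repair
    field
      path    : List (Fin n)
      isRoute : IsRoute Ore u v path
      fewer   : defects path < defects Q
      covers  : Q ⊆ path

  Repair-reverse : ∀ {u v} Q → Repair v u (reverse Q) → Repair u v Q
  Repair-reverse Q (repair Q′ route fewer covers) =
    repair (reverse Q′) (IsRoute-reverse ore-sym route)
      (subst₂ _<_ (sym (breaks-reverse ~-sym Q′)) (breaks-reverse ~-sym Q) fewer)
      (λ z∈ → ∈-resp-↭ (↭-sym (↭-reverse Q′)) (covers (∈-resp-↭ (↭-sym (↭-reverse Q)) z∈)))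

  insert-common-neighbour : ∀ {u v} xs x y ys {w} → IsRoute Ore u v (xs ++ x ∷ y ∷ ys) →
    w ∉ xs ++ x ∷ y ∷ ys → ¬ x ~ y → x ~ w → y ~ w → Repair u v (xs ++ x ∷ y ∷ ys)
  insert-common-neighbour xs x y ys {w} route@(!Q , _) w∉Q x≁y x~w y~w =
    repair (xs ++ x ∷ w ∷ y ∷ ys)
      (IsRoute-splice xs x [] {[ w ]} y ys route (unique-↭ insertion (¬Any⇒All¬ _ w∉Q ∷ !Q))
        (inj₁ x~w ∷ inj₁ (~-sym y~w) ∷ [-]))
      (breaks-splice-< xs x {[]} {[ w ]} y ys fewer)
      (λ z∈ → ∈-resp-↭ insertion (there z∈))
    where
    insertion : w ∷ xs ++ x ∷ y ∷ ys ↭ xs ++ x ∷ w ∷ y ∷ ys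
    insertion = ↭-trans (↭-sym (shift w xs (x ∷ y ∷ ys))) (++⁺ˡ xs (swap w x ↭-refl))
    fewer : defects (x ∷ w ∷ y ∷ []) < defects (x ∷ y ∷ [])
    fewer rewrite gap-related x~w | gap-related (~-sym y~w) | gap-unrelated x≁y = s≤s z≤n

  reverse-segment-after : ∀ {u v} xs x y cs c d ds →
    IsRoute Ore u v (xs ++ x ∷ y ∷ cs ++ c ∷ d ∷ ds) → ¬ x ~ y → x ~ c → y ~ d →
    Repair u v (xs ++ x ∷ y ∷ cs ++ c ∷ d ∷ ds)
  reverse-segment-after {u} {v} xs x y cs c d ds route@(!Q , chain , _) x≁y x~c y~d =
    subst (Repair u v) (sym segment-form)
      (repair (xs ++ x ∷ ms′ ++ d ∷ ds)
        (IsRoute-splice xs x ms {ms′} d ds (subst (IsRoute Ore u v) segment-form route)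
          (unique-↭ segment-reversal (subst Unique segment-form !Q)) chain′)
        (breaks-splice-< xs x {ms} {ms′} d ds fewer)
        (∈-resp-↭ segment-reversal))
    where
    ms ms′ : List (Fin n)
    ms  = y ∷ cs ∷ʳ c
    ms′ = c ∷ reverse cs ∷ʳ y
    segment-form : xs ++ x ∷ y ∷ cs ++ c ∷ d ∷ ds ≡ xs ++ x ∷ ms ++ d ∷ ds
    segment-form = cong (λ ts → xs ++ x ∷ y ∷ ts) (sym (++-assoc cs [ c ] (d ∷ ds)))
    segment-reversal : xs ++ x ∷ ms ++ d ∷ ds ↭ xs ++ x ∷ ms′ ++ d ∷ ds
    segment-reversal = ++⁺ˡ xs (prep x (++⁺ʳ (d ∷ ds)
      (↭-trans (↭-sym (↭-reverse ms)) (↭-reflexive (reverse-∷-∷ʳ y cs c)))))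
    chain-ms : Chain Ore ms
    chain-ms = Chain-++⁻ˡ (y ∷ cs) (Chain-tail (Chain-++⁻ʳ xs chain))
    chain′ : Chain Ore (x ∷ ms′ ∷ʳ d)
    chain′ = inj₁ x~c ∷ Chain-∷ʳ (c ∷ reverse cs)
      (subst (Chain Ore) (reverse-∷-∷ʳ y cs c) (Chain-reverse ore-sym chain-ms)) (inj₁ y~d)
    fewer : defects (x ∷ ms′ ∷ʳ d) < defects (x ∷ ms ∷ʳ d)
    fewer = begin-strict
      gap x c + defects (ms′ ∷ʳ d)
        ≡⟨ cong₂ _+_ (gap-related x~c) (breaks-∷ʳ (c ∷ reverse cs)) ⟩
      defects ms′ + gap y d
        ≡⟨ cong₂ _+_ (cong defects (sym (reverse-∷-∷ʳ y cs c))) (gap-related y~d) ⟩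
      defects (reverse ms) + 0
        ≡⟨ trans (+-identityʳ _) (breaks-reverse ~-sym ms) ⟩
      defects ms
        <⟨ s≤s (m≤m+n _ _) ⟩
      suc (defects ms + gap c d)
        ≡⟨ cong₂ _+_ (sym (gap-unrelated x≁y)) (sym (breaks-∷ʳ (y ∷ cs))) ⟩
      gap x y + defects (ms ∷ʳ d) ∎
      where open ≤-Reasoning

  reverse-segment-before : ∀ {u v} xs x y ys cs c d ds → reverse xs ≡ cs ++ c ∷ d ∷ ds →
    IsRoute Ore u v (xs ++ x ∷ y ∷ ys) → ¬ x ~ y → y ~ c → x ~ d → Repair u v (xs ++ x ∷ y ∷ ys)
  reverse-segment-before {u} {v} xs x y ys cs c d ds xs-form route x≁y y~c x~d =
    Repair-reverse (xs ++ x ∷ y ∷ ys) (subst (Repair v u) (sym reversed)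
      (reverse-segment-after (reverse ys) y x cs c d ds
        (subst (IsRoute Ore v u) reversed (IsRoute-reverse ore-sym route)) (x≁y ∘ ~-sym) y~c x~d))
    where
    reversed : reverse (xs ++ x ∷ y ∷ ys) ≡ reverse ys ++ y ∷ x ∷ cs ++ c ∷ d ∷ ds
    reversed = trans (reverse-++-∷∷ xs x y ys) (cong (λ ts → reverse ys ++ y ∷ x ∷ ts) xs-form)

  degIn : Fin n → List (Fin n) → ℕ
  degIn x ws = length (filter (adj? G x) ws)

  degIn-++ : ∀ x ws ws′ → degIn x (ws ++ ws′) ≡ degIn x ws + degIn x ws′
  degIn-++ x ws ws′ = trans (cong length (filter-++ (adj? G x) ws ws′)) (length-++ (filter (adj? G x) ws))

  degIn-↭ : ∀ x {ws ws′} → ws ↭ ws′ → degIn x ws ≡ degIn x ws′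
  degIn-↭ x p = ↭-length (filter-↭ (adj? G x) p)

  degIn-skip : ∀ z xs {a b} ys → ¬ z ~ a → ¬ z ~ b →
    degIn z (xs ++ a ∷ b ∷ ys) ≡ degIn z xs + degIn z ys
  degIn-skip z xs ys z≁a z≁b =
    trans (degIn-++ z xs _) (cong (λ ws → degIn z xs + length ws)
      (trans (filter-reject (adj? G z) z≁a) (filter-reject (adj? G z) z≁b)))

  Crossing : Fin n → Fin n → Fin n → Fin n → Set
  Crossing x y a b = x ~ a × y ~ b

  crossing? : ∀ x y a b → Dec (Crossing x y a b)
  crossing? x y a b = adj? G x a ×-dec adj? G y b

  degIn-around-non-edge : ∀ {x y} xs ys → ¬ x ~ y →
    Chain (λ a b → ¬ Crossing y x a b) (reverse xs) → Chain (λ a b → ¬ Crossing x y a b) ys →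
    degIn x (xs ++ x ∷ y ∷ ys) + degIn y (xs ++ x ∷ y ∷ ys) ≤ length (xs ++ x ∷ y ∷ ys)
  degIn-around-non-edge {x} {y} xs ys x≁y before after = begin
    degIn x (xs ++ x ∷ y ∷ ys) + degIn y (xs ++ x ∷ y ∷ ys)
      ≡⟨ cong₂ _+_ (degIn-skip x xs ys (Graph.irrefl G) x≁y)
                   (degIn-skip y xs ys (x≁y ∘ ~-sym) (Graph.irrefl G)) ⟩
    (degIn x xs + degIn x ys) + (degIn y xs + degIn y ys)
      ≡⟨ interchange (degIn x xs) (degIn x ys) (degIn y xs) (degIn y ys) ⟩
    (degIn x xs + degIn y xs) + (degIn x ys + degIn y ys)
      ≡⟨ cong (_+ (degIn x ys + degIn y ys))
              (trans (+-comm (degIn x xs) _) (cong₂ _+_ (reversed y) (reversed x))) ⟩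
    (degIn y (reverse xs) + degIn x (reverse xs)) + (degIn x ys + degIn y ys)
      ≤⟨ +-mono-≤ (length-filter-+-≤-suc-length (adj? G y) (adj? G x) before)
                  (length-filter-+-≤-suc-length (adj? G x) (adj? G y) after) ⟩
    suc (length (reverse xs)) + suc (length ys)
      ≡⟨ cong (λ k → suc k + suc (length ys)) (length-reverse xs) ⟩
    suc (length xs + suc (length ys))
      ≡⟨ sym (+-suc (length xs) (suc (length ys))) ⟩
    length xs + length (x ∷ y ∷ ys)
      ≡⟨ sym (length-++ xs) ⟩
    length (xs ++ x ∷ y ∷ ys) ∎
    where
    open ≤-Reasoning
    reversed : ∀ z → degIn z xs ≡ degIn z (reverse xs)
    reversed z = degIn-↭ z (↭-sym (↭-reverse xs))

  outside : List (Fin n) → List (Fin n)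
  outside Q = filter (_∉? Q) (allFin n)

  degree-sum-≤ : ∀ {x y} Q → Unique Q → All (λ w → ¬ (x ~ w × y ~ w)) (outside Q) →
    degIn x Q + degIn y Q ≤ length Q → deg G x + deg G y ≤ n
  degree-sum-≤ {x} {y} Q !Q alone on-Q = begin
    deg G x + deg G y
      ≡⟨ cong₂ _+_ (deg-split x) (deg-split y) ⟩
    (degIn x Q + degIn x (outside Q)) + (degIn y Q + degIn y (outside Q))
      ≡⟨ interchange (degIn x Q) (degIn x (outside Q)) (degIn y Q) (degIn y (outside Q)) ⟩
    (degIn x Q + degIn y Q) + (degIn x (outside Q) + degIn y (outside Q))
      ≤⟨ +-mono-≤ on-Q (length-filter-+-≤-length (adj? G x) (adj? G y) alone) ⟩
    length Q + length (outside Q)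
      ≡⟨ sym (length-++ Q) ⟩
    length (Q ++ outside Q)
      ≡⟨ sym (↭-length everything) ⟩
    length (allFin n)
      ≡⟨ length-tabulate _ ⟩
    n ∎
    where
    open ≤-Reasoning
    everything : allFin n ↭ Q ++ outside Q
    everything = ↭-++-complement Fin._≟_ !Q (Unique.allFin⁺ n) (λ {q} _ → ∈-allFin q)
    deg-split : ∀ z → deg G z ≡ degIn z Q + degIn z (outside Q)
    deg-split z = trans (degIn-↭ z everything) (degIn-++ z Q (outside Q))

  repair-non-edge : ∀ {u v} xs x y ys → IsRoute Ore u v (xs ++ x ∷ y ∷ ys) → ¬ x ~ y →
    n + 1 ≤ deg G x + deg G y → Repair u v (xs ++ x ∷ y ∷ ys)
  repair-non-edge xs x y ys route x≁y big
    with any? (λ w → adj? G x w ×-dec adj? G y w) (outside (xs ++ x ∷ y ∷ ys))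
  ... | yes common =
    let w , w∈outside , x~w , y~w = find common
        w∉Q = proj₂ (∈-filter⁻ (_∉? _) {xs = allFin n} w∈outside)
    in insert-common-neighbour xs x y ys route w∉Q x≁y x~w y~w
  ... | no none
    with chain-or-split (crossing? x y) ys | chain-or-split (crossing? y x) (reverse xs)
  ... | inj₂ (split cs ds refl (x~c , y~d)) | _ =
    reverse-segment-after xs x y cs _ _ ds route x≁y x~c y~d
  ... | _ | inj₂ (split cs ds eq (y~c , x~d)) =
    reverse-segment-before xs x y ys cs _ _ ds eq route x≁y y~c x~d
  ... | inj₁ after | inj₁ before =
    contradiction (≤-trans big (degree-sum-≤ (xs ++ x ∷ y ∷ ys) (proj₁ route) (¬Any⇒All¬ _ none)
      (degIn-around-non-edge xs ys x≁y before after))) (m+1+n≰m n)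

  PathThrough : Fin n → Fin n → List (Fin n) → Set
  PathThrough u v Q = Σ (List (Fin n)) (λ Q′ → IsPath G u v Q′ × Q ⊆ Q′)

  ore-route⇒path : ∀ {u v} Q → IsRoute Ore u v Q → PathThrough u v Q
  ore-route⇒path Q route = go Q route (<-wellFounded (defects Q))
    where
    go : ∀ {u v} Q → IsRoute Ore u v Q → Acc _<_ (defects Q) → PathThrough u v Q
    go Q route@(!Q , chain , ends) (acc smaller) with chain-or-split (λ a b → ¬? (adj? G a b)) Q
    ... | inj₁ adjacent =
      Q , (!Q , Chain-map (λ {a} {b} → decidable-stable (adj? G a b)) adjacent , ends) , λ z∈ → z∈
    ... | inj₂ (split xs ys refl x≁y)
      with repair-non-edge xs _ _ ys route x≁y (ore-degree (Chain-head (Chain-++⁻ʳ xs chain)) x≁y)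
    ... | repair Q′ route′ fewer covers with go Q′ route′ (smaller fewer)
    ... | Q″ , path , covers′ = Q″ , path , λ z∈ → covers′ (covers z∈)

lemma4p1 : ∀ {n} (G : Graph n) (u v : Fin n) → n + 1 ≤ deg G u + deg G v →
    (P : List (Fin n)) → IsOrePath G u v P →
    Σ (List (Fin n)) (λ Q → IsPath G u v Q × (∀ {x} → x ∈ P → x ∈ Q))
lemma4p1 G u v _ P (_ , route) = ore-route⇒path G P route
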